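{- Let $n\ge 4$. The packing number of $C_9\Box P_n$ is \[ \rho(C_9\Box P_n)= 2n-\left\lfloor \frac{n}{3}\right\rfloor. \]
   Context: All graphs are finite and simple; $N[v]$ denotes the closed neighborhood of a vertex $v$. A set $D\subseteq V(G)$ is a packing of $G$ if $N[u]\cap N[v]=\emptyset$ for all distinct $u,v\in D$; the packing number $\rho(G)$ is the maximum cardinality of a packing of $G$. $C_m\Box P_n$ denotes the Cartesian product of the cycle $C_m$ and the path $P_n$ on $n$ vertices: its vertices are pairs $(i,j)$ with $i\in\{0,\dots,m-1\}$, $j\in\{0,\dots,n-1\}$, and $(i,j)$ is adjacent to $(i',j')$ iff either $j=j'$ and $i-i'\equiv\pm1\pmod m$, or $i=i'$ and $|j-j'|=1$. -}

module Defs where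

open import Data.Nat using (ℕ; suc; _+_; _≤_)
open import Data.Fin using (Fin; toℕ)
open import Data.Product using (_×_; _,_; ∃)
open import Data.Sum using (_⊎_)
open import Data.List using (List; length)
open import Data.List.Membership.Propositional using (_∈_)
open import Data.List.Relation.Unary.Unique.Propositional using (Unique)
open import Relation.Binary.PropositionalEquality using (_≡_)
open import Relation.Nullary using (¬_)

Vertex : ℕ → ℕ → Set
Vertex m n = Fin m × Fin n

CycSucc : (m : ℕ) → Fin m → Fin m → Set
CycSucc m i i' = (suc (toℕ i) ≡ toℕ i') ⊎ ((suc (toℕ i) ≡ m) × (toℕ i' ≡ 0))

CycAdj : (m : ℕ) → Fin m → Fin m → Set
CycAdj m i i' = CycSucc m i i' ⊎ CycSucc m i' i

PathAdj : (n : ℕ) → Fin n → Fin n → Set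
PathAdj n j j' = (suc (toℕ j) ≡ toℕ j') ⊎ (suc (toℕ j') ≡ toℕ j)

Adj : (m n : ℕ) → Vertex m n → Vertex m n → Set
Adj m n (i , j) (i' , j') = (j ≡ j' × CycAdj m i i') ⊎ (i ≡ i' × PathAdj n j j')

InClosedNbhd : (m n : ℕ) → Vertex m n → Vertex m n → Set
InClosedNbhd m n w v = (w ≡ v) ⊎ Adj m n v w

DisjointNbhds : (m n : ℕ) → Vertex m n → Vertex m n → Set
DisjointNbhds m n u v = ¬ (∃ λ w → InClosedNbhd m n w u × InClosedNbhd m n w v)

IsPacking : (m n : ℕ) → List (Vertex m n) → Set
IsPacking m n D = Unique D ×
  (∀ u v → u ∈ D → v ∈ D → ¬ (u ≡ v) → DisjointNbhds m n u v)

PackingNumberIs : (m n : ℕ) → ℕ → Set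
PackingNumberIs m n k =
  (∃ λ D → IsPacking m n D × length D ≡ k) ×
  (∀ D → IsPacking m n D → length D ≤ k)

module Submission where

-- A set of vertices of C_m □ P_n is a packing exactly when, column by column, every column is
-- a packing of C_m, the rows used by adjacent columns are at cyclic distance at least 2, and
-- columns two apart use disjoint rows.  For m = 9 there are 31 packings of a column, and a
-- max-plus transfer matrix on pairs of adjacent columns bounds the size of such a column
-- sequence: its iterates bound windows of 4, 5, 6 columns by 7, 9, 10, and three further
-- iterations raise every entry by at most 5.  This gives ρ(C₉ □ P_n) ≤ 2n - ⌊n/3⌋ for n ≥ 4,
-- and repeating the columns {0,4}, {2,6}, {8}, shifted by one row every three columns,
-- attains the bound.


open import Defs
open import Data.Bool using (Bool; true; false; _∧_; if_then_else_)
open import Data.Bool.Properties using () renaming (_≟_ to _≟ᵇ_)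
open import Data.Empty using (⊥; ⊥-elim)
open import Data.Fin using (Fin; zero; suc; toℕ; _≟_)
open import Data.Fin.Properties using (all?; any?; toℕ-injective; toℕ<n; toℕ-fromℕ<)
open import Data.Fin.Subset using (Subset; inside; outside; _∈_; _∉_; ∣_∣; ⋃; ⁅_⁆)
open import Data.Fin.Subset.Properties using (_∈?_; drop-there)
open import Data.List using (List; []; _∷_; _++_; map; filter; length; lookup; applyUpTo; upTo; allFin; tabulate; cartesianProductWith)
open import Data.List.Properties using (length-++; filter-++; filter-≐; map-cong; map-tabulate)
open import Data.List.Membership.Propositional using () renaming (_∈_ to _∈ˡ_; _∉_ to _∉ˡ_)
open import Data.List.Membership.Propositional.Properties using (∈-filter⁺; ∈-filter⁻; ∈-allFin; ∈-cartesianProductWith⁺; ∈-++⁺ˡ; ∈-++⁺ʳ; ∈-map⁺)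
open import Data.List.Membership.Propositional.Properties.WithK using (unique∧set⇒bag)
open import Data.List.Relation.Binary.BagAndSetEquality using (∼bag⇒↭)
open import Data.List.Relation.Binary.Permutation.Propositional.Properties using (↭-length)
open import Data.List.Relation.Unary.Any using (Any; index)
import Data.List.Relation.Unary.Any as Any
open import Data.List.Relation.Unary.Any.Properties using (lookup-index)
open import Data.List.Relation.Unary.Unique.Propositional using (Unique)
open import Data.List.Relation.Unary.Unique.Propositional.Properties using (filter⁺; cartesianProductWith⁺; allFin⁺)
open import Data.Nat using (ℕ; zero; suc; _+_; _*_; _∸_; _/_; _≤_; _≤?_; _⊔_; z≤n; s≤s)
import Data.Nat as ℕ
open import Data.Nat.DivMod using (_mod_; m/n≡1+[m∸n]/n; m/n≤m)
open import Data.Nat.ListAction using (sum)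
open import Data.Nat.Properties
  using (1+n≢n; <⇒≢; n<1+n; m<n⇒m<1+n; n≤1+n; suc-injective; ≤-trans; ≤-reflexive; m≤m+n; m≤m⊔n; m≤n⊔m; ⊔-mono-≤;
         +-distribʳ-⊔; +-monoʳ-≤; +-monoˡ-≤; +-assoc; +-comm; +-identityʳ; *-distribˡ-+; +-∸-assoc; module ≤-Reasoning)
open import Data.Product using (_×_; _,_; proj₁; proj₂; ∃)
open import Data.Product.Properties using () renaming (≡-dec to ×-≡-dec)
open import Data.Sum using (_⊎_; inj₁; inj₂)
open import Data.Vec using (Vec; _∷_; there) renaming (tabulate to tabulateᵛ; lookup to lookupᵛ)
open import Data.Vec.Properties using (lookup∘tabulate; []=⇒lookup; lookup⇒[]=) renaming (≡-dec to ≡-decᵛ)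
open import Data.List.Membership.DecPropositional (≡-decᵛ {n = 9} _≟ᵇ_) using () renaming (_∈?_ to _∈ˡ?_)
open import Function using (_∘_; _⇔_; mk⇔)
open import Relation.Binary using (Decidable; DecidableEquality)
open import Relation.Binary.PropositionalEquality using (_≡_; refl; sym; trans; cong; cong₂; subst; subst₂; module ≡-Reasoning)
open import Relation.Nullary using (Dec; yes; does; ¬_)
open import Relation.Nullary.Decidable using (_×-dec_; _⊎-dec_; _→-dec_; ¬?; dec-true; decidable-stable)
open import Relation.Unary using () renaming (Decidable to Decidable₁)

-- Used as `decided a? refl`: the type checker then evaluates only the boolean `does a?`.
decided : {A : Set} (a? : Dec A) → does a? ≡ true → A
decided (yes a) _ = a

sum-applyUpTo-cong : ∀ {f g : ℕ → ℕ} → (∀ c → f c ≡ g c) → ∀ n → sum (applyUpTo f n) ≡ sum (applyUpTo g n)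
sum-applyUpTo-cong f≗g zero    = refl
sum-applyUpTo-cong f≗g (suc n) = cong₂ _+_ (f≗g 0) (sum-applyUpTo-cong (f≗g ∘ suc) n)

sum-tabulate-toℕ : ∀ n (f : ℕ → ℕ) → sum (tabulate {n = n} (f ∘ toℕ)) ≡ sum (applyUpTo f n)
sum-tabulate-toℕ zero    f = refl
sum-tabulate-toℕ (suc n) f = cong (f 0 +_) (sum-tabulate-toℕ n (f ∘ suc))

module _ {A B : Set} {P : A → Set} (P? : Decidable₁ P) where

  length-filter-map : ∀ (f : B → A) xs → length (filter P? (map f xs)) ≡ length (filter (P? ∘ f) xs)
  length-filter-map f []       = refl
  length-filter-map f (x ∷ xs) with does (P? (f x))
  ... | true  = cong suc (length-filter-map f xs)
  ... | false = length-filter-map f xs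

  length-filter-cartesianProductWith : ∀ {C : Set} (f : C → B → A) xs ys →
    length (filter P? (cartesianProductWith f xs ys)) ≡ sum (map (λ x → length (filter P? (map (f x) ys))) xs)
  length-filter-cartesianProductWith f []       ys = refl
  length-filter-cartesianProductWith f (x ∷ xs) ys = begin
    length (filter P? (map (f x) ys ++ cartesianProductWith f xs ys))
      ≡⟨ cong length (filter-++ P? (map (f x) ys) _) ⟩
    length (filter P? (map (f x) ys) ++ filter P? (cartesianProductWith f xs ys))
      ≡⟨ length-++ (filter P? (map (f x) ys)) ⟩
    length (filter P? (map (f x) ys)) + length (filter P? (cartesianProductWith f xs ys))
      ≡⟨ cong (length (filter P? (map (f x) ys)) +_) (length-filter-cartesianProductWith f xs ys) ⟩
    length (filter P? (map (f x) ys)) + sum (map (λ x → length (filter P? (map (f x) ys))) xs) ∎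
    where open ≡-Reasoning

length-filter-∈-∷ : ∀ {m} b (p : Subset m) →
                    length (filter (_∈? p) (allFin m)) ≡ length (filter (_∈? (b ∷ p)) (tabulate suc))
length-filter-∈-∷ {m} b p = begin
  length (filter (_∈? p) (allFin m))
    ≡⟨ cong length (filter-≐ (_∈? p) (λ x → suc x ∈? (b ∷ p)) (there , drop-there) (allFin m)) ⟩
  length (filter (λ x → suc x ∈? (b ∷ p)) (allFin m))
    ≡⟨ length-filter-map (_∈? (b ∷ p)) suc (allFin m) ⟨
  length (filter (_∈? (b ∷ p)) (map suc (allFin m)))
    ≡⟨ cong (length ∘ filter (_∈? (b ∷ p))) (map-tabulate (λ x → x) suc) ⟩
  length (filter (_∈? (b ∷ p)) (tabulate suc)) ∎
  where open ≡-Reasoning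

∣p∣≡length-filter : ∀ {m} (p : Subset m) → ∣ p ∣ ≡ length (filter (_∈? p) (allFin m))
∣p∣≡length-filter {zero}  Data.Vec.[]   = refl
∣p∣≡length-filter {suc m} (inside ∷ p)  = cong suc (trans (∣p∣≡length-filter p) (length-filter-∈-∷ inside p))
∣p∣≡length-filter {suc m} (outside ∷ p) = trans (∣p∣≡length-filter p) (length-filter-∈-∷ outside p)

module _ {A : Set} where

  filter-≡[]⇒∉ : ∀ {P : A → Set} {P? : Decidable₁ P} {xs x} → filter P? xs ≡ [] → x ∈ˡ xs → ¬ P x
  filter-≡[]⇒∉ {P? = P?} {x = x} filter≡[] x∈ px with subst (x ∈ˡ_) filter≡[] (∈-filter⁺ P? x∈ px)
  ... | ()

  unique∧set⇒length≡ : ∀ {xs ys : List A} → Unique xs → Unique ys →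
                    (∀ {x} → x ∈ˡ xs ⇔ x ∈ˡ ys) → length xs ≡ length ys
  unique∧set⇒length≡ xs! ys! xs⇔ys = ↭-length (∼bag⇒↭ (unique∧set⇒bag xs! ys! xs⇔ys))

-- Packings of C_m □ P_n, column by column

module _ {m : ℕ} where

  CycNbhd : Fin m → Fin m → Set
  CycNbhd x z = z ≡ x ⊎ CycAdj m x z

  cycNbhd-sym : ∀ {x z} → CycNbhd x z → CycNbhd z x
  cycNbhd-sym (inj₁ refl)      = inj₁ refl
  cycNbhd-sym (inj₂ (inj₁ x→z)) = inj₂ (inj₂ x→z)
  cycNbhd-sym (inj₂ (inj₂ z→x)) = inj₂ (inj₁ z→x)

  cycSucc? : Decidable (CycSucc m)
  cycSucc? x y = (suc (toℕ x) ℕ.≟ toℕ y) ⊎-dec ((suc (toℕ x) ℕ.≟ m) ×-dec (toℕ y ℕ.≟ 0))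

  cycNbhd? : Decidable CycNbhd
  cycNbhd? x z = (z ≟ x) ⊎-dec (cycSucc? x z ⊎-dec cycSucc? z x)

  IsColumnPacking : Subset m → Set
  IsColumnPacking p = ∀ x z y → x ∈ p → CycNbhd x z → y ∈ p → CycNbhd y z → x ≡ y

  isColumnPacking? : ∀ p → Dec (IsColumnPacking p)
  isColumnPacking? p = all? λ x → all? λ z → all? λ y →
    (x ∈? p) →-dec (cycNbhd? x z →-dec ((y ∈? p) →-dec (cycNbhd? y z →-dec (x ≟ y))))

  Separated : Subset m → Subset m → Set
  Separated p q = ∀ x y → x ∈ p → y ∈ q → ¬ CycNbhd x y

  separated? : Decidable Separated
  separated? p q = all? λ x → all? λ y → (x ∈? p) →-dec ((y ∈? q) →-dec ¬? (cycNbhd? x y))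

  Disjoint : Subset m → Subset m → Set
  Disjoint p q = ∀ x → x ∈ p → x ∉ q

  disjoint? : Decidable Disjoint
  disjoint? p q = all? λ x → (x ∈? p) →-dec ¬? (x ∈? q)

  record IsColumnwisePacking (P : ℕ → Subset m) : Set where
    field
      packing   : ∀ c → IsColumnPacking (P c)
      separated : ∀ c → Separated (P c) (P (suc c))
      disjoint  : ∀ c → Disjoint (P c) (P (suc (suc c)))

module _ {m n : ℕ} where

  _≟ᵛ_ : DecidableEquality (Vertex m n)
  _≟ᵛ_ = ×-≡-dec _≟_ _≟_

  vertices : List (Vertex m n)
  vertices = cartesianProductWith (λ j x → x , j) (allFin n) (allFin m)

  ∈-vertices : ∀ v → v ∈ˡ vertices
  ∈-vertices (x , j) = ∈-cartesianProductWith⁺ (λ j x → x , j) (∈-allFin j) (∈-allFin x)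

  vertices-unique : Unique vertices
  vertices-unique = cartesianProductWith⁺ (λ j x → x , j) (λ { refl → refl , refl }) (allFin⁺ n) (allFin⁺ m)

  closedNbhd-cyc : ∀ {x z j} → CycNbhd x z → InClosedNbhd m n (z , j) (x , j)
  closedNbhd-cyc (inj₁ refl) = inj₁ refl
  closedNbhd-cyc (inj₂ x∼z)  = inj₂ (inj₁ (refl , x∼z))

  closedNbhd-next : ∀ {x i j} → suc (toℕ i) ≡ toℕ j → InClosedNbhd m n (x , j) (x , i)
  closedNbhd-next i→j = inj₂ (inj₂ (refl , inj₁ i→j))

  closedNbhd-previous : ∀ {x i j} → suc (toℕ j) ≡ toℕ i → InClosedNbhd m n (x , j) (x , i)
  closedNbhd-previous j→i = inj₂ (inj₂ (refl , inj₂ j→i))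

  data Near (x : Fin m) (j : Fin n) : Vertex m n → Set where
    same-column : ∀ {y} → CycNbhd y x → Near x j (y , j)
    previous    : ∀ {i} → suc (toℕ i) ≡ toℕ j → Near x j (x , i)
    next        : ∀ {i} → suc (toℕ j) ≡ toℕ i → Near x j (x , i)

  near : ∀ {w u} → InClosedNbhd m n w u → Near (proj₁ w) (proj₂ w) u
  near (inj₁ refl)                     = same-column (inj₁ refl)
  near (inj₂ (inj₁ (refl , y∼x)))      = same-column (inj₂ y∼x)
  near (inj₂ (inj₂ (refl , inj₁ i→j))) = previous i→j
  near (inj₂ (inj₂ (refl , inj₂ j→i))) = next j→i

  InColumns : (ℕ → Subset m) → Vertex m n → Set
  InColumns P (x , j) = x ∈ P (toℕ j)

  inColumns? : ∀ P → Decidable₁ (InColumns P)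
  inColumns? P (x , j) = x ∈? P (toℕ j)

  realise : (ℕ → Subset m) → List (Vertex m n)
  realise P = filter (inColumns? P) vertices

  ∈-realise⁺ : ∀ {P v} → InColumns P v → v ∈ˡ realise P
  ∈-realise⁺ {P} {v} = ∈-filter⁺ (inColumns? P) (∈-vertices v)

  ∈-realise⁻ : ∀ {P v} → v ∈ˡ realise P → InColumns P v
  ∈-realise⁻ {P} = proj₂ ∘ ∈-filter⁻ (inColumns? P) {xs = vertices}

  length-realise : ∀ P → length (realise P) ≡ sum (applyUpTo (∣_∣ ∘ P) n)
  length-realise P = begin
    length (filter (inColumns? P) vertices)
      ≡⟨ length-filter-cartesianProductWith (inColumns? P) (λ j x → x , j) (allFin n) (allFin m) ⟩
    sum (map (λ j → length (filter (inColumns? P) (map (λ x → x , j) (allFin m)))) (allFin n))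
      ≡⟨ cong sum (map-cong column-length (allFin n)) ⟩
    sum (map (∣_∣ ∘ P ∘ toℕ) (allFin n))
      ≡⟨ cong sum (map-tabulate {n = n} (λ j → j) (∣_∣ ∘ P ∘ toℕ)) ⟩
    sum (tabulate {n = n} (∣_∣ ∘ P ∘ toℕ))
      ≡⟨ sum-tabulate-toℕ n (∣_∣ ∘ P) ⟩
    sum (applyUpTo (∣_∣ ∘ P) n) ∎
    where
    open ≡-Reasoning
    column-length : ∀ j → length (filter (inColumns? P) (map (λ x → x , j) (allFin m))) ≡ ∣ P (toℕ j) ∣
    column-length j = trans (length-filter-map (inColumns? P) (λ x → x , j) (allFin m))
                            (sym (∣p∣≡length-filter (P (toℕ j))))

  module _ {P : ℕ → Subset m} (P-ok : IsColumnwisePacking P) where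
    open IsColumnwisePacking P-ok

    private
      column-previous : ∀ {x y} {i j : Fin n} → InColumns P (y , j) → InColumns P (x , i) →
                        CycNbhd y x → suc (toℕ i) ≡ toℕ j → ⊥
      column-previous y∈ x∈ y∼x i→j = separated _ _ _ x∈ (subst (λ c → _ ∈ P c) (sym i→j) y∈) (cycNbhd-sym y∼x)

      column-next : ∀ {x y} {i j : Fin n} → InColumns P (y , j) → InColumns P (x , i) →
                    CycNbhd y x → suc (toℕ j) ≡ toℕ i → ⊥
      column-next y∈ x∈ y∼x j→i = separated _ _ _ y∈ (subst (λ c → _ ∈ P c) (sym j→i) x∈) y∼x

      previous-next : ∀ {x} {i i′ j : Fin n} → InColumns P (x , i) → InColumns P (x , i′) →
                      suc (toℕ i) ≡ toℕ j → suc (toℕ j) ≡ toℕ i′ → ⊥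
      previous-next {x} x∈ x∈′ i→j j→i′ = disjoint _ x x∈ (subst (λ c → x ∈ P c) (sym (trans (cong suc i→j) j→i′)) x∈′)

    near-unique : ∀ {x j u v} → InColumns P u → InColumns P v → Near x j u → Near x j v → u ≡ v
    near-unique {j = j} u∈ v∈ (same-column y∼x) (same-column y′∼x) = cong (_, j) (packing _ _ _ _ u∈ y∼x v∈ y′∼x)
    near-unique u∈ v∈ (same-column y∼x) (previous i→j)     = ⊥-elim (column-previous u∈ v∈ y∼x i→j)
    near-unique u∈ v∈ (previous i→j)    (same-column y∼x)  = ⊥-elim (column-previous v∈ u∈ y∼x i→j)
    near-unique u∈ v∈ (same-column y∼x) (next j→i)         = ⊥-elim (column-next u∈ v∈ y∼x j→i)
    near-unique u∈ v∈ (next j→i)        (same-column y∼x)  = ⊥-elim (column-next v∈ u∈ y∼x j→i)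
    near-unique u∈ v∈ (previous i→j)    (next j→i′)        = ⊥-elim (previous-next u∈ v∈ i→j j→i′)
    near-unique u∈ v∈ (next j→i′)       (previous i→j)     = ⊥-elim (previous-next v∈ u∈ i→j j→i′)
    near-unique {x} u∈ v∈ (previous i→j) (previous i′→j) = cong (x ,_) (toℕ-injective {n} (suc-injective (trans i→j (sym i′→j))))
    near-unique {x} u∈ v∈ (next j→i) (next j→i′) = cong (x ,_) (toℕ-injective {n} (trans (sym j→i) j→i′))

  realise-isPacking : ∀ {P} → IsColumnwisePacking P → IsPacking m n (realise P)
  realise-isPacking {P} P-ok = filter⁺ (inColumns? P) vertices-unique ,
    λ u v u∈ v∈ u≢v (w , w∼u , w∼v) →
      u≢v (near-unique P-ok (∈-realise⁻ {P} u∈) (∈-realise⁻ {P} v∈) (near w∼u) (near w∼v))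

  inColumn? : ∀ (D : List (Vertex m n)) c x → Dec (∃ λ j → toℕ j ≡ c × (x , j) ∈ˡ D)
  inColumn? D c x = any? λ j → (toℕ j ℕ.≟ c) ×-dec Any.any? ((x , j) ≟ᵛ_) D

  columns : List (Vertex m n) → ℕ → Subset m
  columns D c = tabulateᵛ (λ x → does (inColumn? D c x))

  ∈-columns⁻ : ∀ {D c x} → x ∈ columns D c → ∃ λ j → toℕ j ≡ c × (x , j) ∈ˡ D
  ∈-columns⁻ {D} {c} {x} x∈ = decided (inColumn? D c x) (trans (sym (lookup∘tabulate _ x)) ([]=⇒lookup x∈))

  ∈-columns⁺ : ∀ {D x j} → (x , j) ∈ˡ D → x ∈ columns D (toℕ j)
  ∈-columns⁺ {D} {x} {j} x,j∈ =
    lookup⇒[]= x _ (trans (lookup∘tabulate _ x) (dec-true (inColumn? D (toℕ j) x) (j , refl , x,j∈)))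

  packing-clash : ∀ {D u v w} → IsPacking m n D → u ∈ˡ D → v ∈ˡ D →
                  InClosedNbhd m n w u → InClosedNbhd m n w v → u ≡ v
  packing-clash {u = u} {v} (_ , disjoint) u∈ v∈ w∼u w∼v =
    decidable-stable (u ≟ᵛ v) (λ u≢v → disjoint _ _ u∈ v∈ u≢v (_ , w∼u , w∼v))

  columns-isColumnwisePacking : ∀ {D} → IsPacking m n D → IsColumnwisePacking (columns D)
  columns-isColumnwisePacking {D} D-ok = record
    { packing   = packing
    ; separated = separated
    ; disjoint  = disjoint
    }
    where
    packing : ∀ c → IsColumnPacking (columns D c)
    packing c x z y x∈ x∼z y∈ y∼z with ∈-columns⁻ x∈ | ∈-columns⁻ y∈
    ... | j , refl , x,j∈ | j′ , j′≡j , y,j′∈ with toℕ-injective j′≡j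
    ... | refl = cong proj₁ (packing-clash D-ok x,j∈ y,j′∈ (closedNbhd-cyc x∼z) (closedNbhd-cyc y∼z))

    separated : ∀ c → Separated (columns D c) (columns D (suc c))
    separated c x y x∈ y∈ x∼y with ∈-columns⁻ x∈ | ∈-columns⁻ y∈
    ... | j , refl , x,j∈ | j′ , j→j′ , y,j′∈ =
      1+n≢n (sym (trans (cong (toℕ ∘ proj₂) (packing-clash D-ok x,j∈ y,j′∈ (closedNbhd-cyc x∼y) (closedNbhd-previous (sym j→j′)))) j→j′))

    disjoint : ∀ c → Disjoint (columns D c) (columns D (suc (suc c)))
    disjoint c x x∈ x∈′ with ∈-columns⁻ x∈ | ∈-columns⁻ x∈′
    ... | j , refl , x,j∈ | j″ , j→→j″ , x,j″∈ =
      <⇒≢ (m<n⇒m<1+n (n<1+n (toℕ j))) (trans (cong (toℕ ∘ proj₂) (packing-clash D-ok x,j∈ x,j″∈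
        (closedNbhd-next (sym (toℕ-fromℕ< middle<n)))
        (closedNbhd-previous (trans (cong suc (toℕ-fromℕ< middle<n)) (sym j→→j″))))) j→→j″)
      where
      middle<n : suc (toℕ j) ℕ.< n
      middle<n = ≤-trans (s≤s (n≤1+n (suc (toℕ j)))) (subst (ℕ._< n) j→→j″ (toℕ<n j″))

  length-packing : ∀ {D} → IsPacking m n D → length D ≡ length (realise (columns D))
  length-packing {D} D-ok = unique∧set⇒length≡ (proj₁ D-ok) (filter⁺ (inColumns? (columns D)) vertices-unique)
    (mk⇔ (∈-realise⁺ {columns D} ∘ ∈-columns⁺) from)
    where
    from : ∀ {v} → v ∈ˡ realise (columns D) → v ∈ˡ D
    from {x , j} v∈ with ∈-columns⁻ (∈-realise⁻ {columns D} v∈)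
    ... | j′ , j′≡j , x,j′∈ = subst (λ j → (x , j) ∈ˡ D) (toℕ-injective j′≡j) x,j′∈

-- A transfer-matrix bound

module _ {A : Set} {k : ℕ} where

  _[_,_] : Vec (Vec A k) k → Fin k → Fin k → A
  M [ a , b ] = lookupᵛ (lookupᵛ M a) b

  tabulate-[,] : ∀ (f : Fin k → Fin k → A) a b → tabulateᵛ (λ a → tabulateᵛ (f a)) [ a , b ] ≡ f a b
  tabulate-[,] f a b = trans (cong (λ row → lookupᵛ row b) (lookup∘tabulate _ a)) (lookup∘tabulate (f a) b)

gatedMax : ∀ {k} → Vec Bool k → Vec Bool k → Vec ℕ k → ℕ
gatedMax Data.Vec.[] Data.Vec.[] Data.Vec.[] = 0
gatedMax (x ∷ xs) (y ∷ ys) (u ∷ us) = (if x ∧ y then u else 0) ⊔ gatedMax xs ys us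

gatedMax-≥ : ∀ {k} (xs ys : Vec Bool k) (us : Vec ℕ k) c →
             lookupᵛ xs c ≡ true → lookupᵛ ys c ≡ true → lookupᵛ us c ≤ gatedMax xs ys us
gatedMax-≥ (true ∷ xs) (true ∷ ys) (u ∷ us) zero refl refl = m≤m⊔n u _
gatedMax-≥ (x ∷ xs) (y ∷ ys) (u ∷ us) (suc c) xc yc =
  ≤-trans (gatedMax-≥ xs ys us c xc yc) (m≤n⊔m _ _)

gatedMax-dominated : ∀ {k} (xs ys : Vec Bool k) (us vs : Vec ℕ k) d →
                     (∀ c → lookupᵛ us c ≤ lookupᵛ vs c + d) →
                     gatedMax xs ys us ≤ gatedMax xs ys vs + d
gatedMax-dominated Data.Vec.[] Data.Vec.[] Data.Vec.[] Data.Vec.[] d _ = z≤n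
gatedMax-dominated (x ∷ xs) (y ∷ ys) (u ∷ us) (v ∷ vs) d u≤v+d =
  ≤-trans (⊔-mono-≤ (gate (x ∧ y)) (gatedMax-dominated xs ys us vs d (u≤v+d ∘ suc)))
          (≤-reflexive (sym (+-distribʳ-⊔ d (if x ∧ y then v else 0) (gatedMax xs ys vs))))
  where
  gate : ∀ b → (if b then u else 0) ≤ (if b then v else 0) + d
  gate true  = u≤v+d zero
  gate false = z≤n

module TransferBound {k : ℕ} (weight : Vec ℕ k) (adjacent nextButOne : Vec (Vec Bool k) k) where

  Table : Set
  Table = Vec (Vec ℕ k) k

  Admissible : (ℕ → Fin k) → Set
  Admissible s = ∀ c → adjacent [ s c , s (suc c) ] ≡ true × nextButOne [ s c , s (suc (suc c)) ] ≡ true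

  Dominated : Table → Table → ℕ → Set
  Dominated U V d = ∀ a b → U [ a , b ] ≤ V [ a , b ] + d

  dominated? : ∀ U V d → Dec (Dominated U V d)
  dominated? U V d = all? λ a → all? λ b → U [ a , b ] ≤? V [ a , b ] + d

  BoundedBy : Table → ℕ → Set
  BoundedBy U d = ∀ a b → U [ a , b ] ≤ d

  boundedBy? : ∀ U d → Dec (BoundedBy U d)
  boundedBy? U d = all? λ a → all? λ b → U [ a , b ] ≤? d

  extendEntry : Table → Fin k → Fin k → ℕ
  extendEntry U a b =
    if adjacent [ a , b ]
    then lookupᵛ weight a + gatedMax (lookupᵛ adjacent b) (lookupᵛ nextButOne a) (lookupᵛ U b)
    else 0

  extend : Table → Table
  extend U = tabulateᵛ λ a → tabulateᵛ λ b → extendEntry U a b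

  -- `extend` takes the previous table as an argument so that it is evaluated only once;
  -- `table` is opaque so that the type checker never unfolds a concrete table by accident.
  opaque
    table : ℕ → Table
    table zero    = tabulateᵛ λ a → tabulateᵛ λ b → lookupᵛ weight a + lookupᵛ weight b
    table (suc j) = extend (table j)

    window-bound : ∀ j s → Admissible s →
                   sum (applyUpTo (lookupᵛ weight ∘ s) (2 + j)) ≤ table j [ s 0 , s 1 ]
    window-bound zero s _
      rewrite tabulate-[,] (λ a b → lookupᵛ weight a + lookupᵛ weight b) (s 0) (s 1)
      = ≤-reflexive (cong (lookupᵛ weight (s 0) +_) (+-identityʳ _))
    window-bound (suc j) s admissible
      rewrite tabulate-[,] (extendEntry (table j)) (s 0) (s 1)
      with adjacent [ s 0 , s 1 ] | proj₁ (admissible 0)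
    ... | true | refl = +-monoʳ-≤ (lookupᵛ weight (s 0))
      (≤-trans (window-bound j (s ∘ suc) (admissible ∘ suc))
               (gatedMax-≥ (lookupᵛ adjacent (s 1)) (lookupᵛ nextButOne (s 0)) (lookupᵛ (table j) (s 1)) (s 2)
                           (proj₁ (admissible 1)) (proj₂ (admissible 0))))

    table-dominated : ∀ {i j d} → Dominated (table i) (table j) d → Dominated (table (suc i)) (table (suc j)) d
    table-dominated {i} {j} {d} i≤j+d a b
      rewrite tabulate-[,] (extendEntry (table i)) a b | tabulate-[,] (extendEntry (table j)) a b
      with adjacent [ a , b ]
    ... | false = z≤n
    ... | true  = ≤-trans (+-monoʳ-≤ (lookupᵛ weight a) (gatedMax-dominated xs ys (lookupᵛ (table i) b) (lookupᵛ (table j) b) d (i≤j+d b)))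
                          (≤-reflexive (sym (+-assoc (lookupᵛ weight a) (gatedMax xs ys (lookupᵛ (table j) b)) d)))
      where
      xs ys : Vec Bool k
      xs = lookupᵛ adjacent b
      ys = lookupᵛ nextButOne a

-- C₉ □ P_n: the upper bound

ρ₉ : ℕ → ℕ
ρ₉ n = 2 * n ∸ n / 3

ρ₉-step : ∀ n → ρ₉ (3 + n) ≡ 5 + ρ₉ n
ρ₉-step n = begin
  2 * (3 + n) ∸ (3 + n) / 3 ≡⟨ cong₂ _∸_ (*-distribˡ-+ 2 3 n) (m/n≡1+[m∸n]/n {3 + n} {3} (s≤s (s≤s (s≤s z≤n)))) ⟩
  6 + 2 * n ∸ (1 + n / 3)   ≡⟨⟩
  5 + 2 * n ∸ n / 3         ≡⟨ +-∸-assoc 5 (≤-trans (m/n≤m n 3) (m≤m+n n (n + 0))) ⟩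
  5 + (2 * n ∸ n / 3)       ∎
  where open ≡-Reasoning

rows : List ℕ → Subset 9
rows rs = ⋃ (map (λ r → ⁅ r mod 9 ⁆) rs)

rotations : List ℕ → ℕ → List (Subset 9)
rotations shape k = map (λ a → rows (map (a +_) shape)) (upTo k)

-- Up to rotation, a packing of C₉ is ∅, {0}, {0,3}, {0,4} or {0,3,6}.
columnPackings : List (Subset 9)
columnPackings = rows [] ∷ rotations (0 ∷ []) 9 ++ rotations (0 ∷ 3 ∷ []) 9 ++ rotations (0 ∷ 4 ∷ []) 9 ++ rotations (0 ∷ 3 ∷ 6 ∷ []) 3

allSubsets : ∀ k → List (Subset k)
allSubsets zero    = Data.Vec.[] ∷ []
allSubsets (suc k) = map (inside ∷_) (allSubsets k) ++ map (outside ∷_) (allSubsets k)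

∈-allSubsets : ∀ {k} (p : Subset k) → p ∈ˡ allSubsets k
∈-allSubsets Data.Vec.[]   = Any.here refl
∈-allSubsets (inside ∷ p)  = ∈-++⁺ˡ (∈-map⁺ (inside ∷_) (∈-allSubsets p))
∈-allSubsets {suc k} (outside ∷ p) = ∈-++⁺ʳ (map (inside ∷_) (allSubsets k)) (∈-map⁺ (outside ∷_) (∈-allSubsets p))

MissingPacking : Subset 9 → Set
MissingPacking p = IsColumnPacking p × p ∉ˡ columnPackings

missingPacking? : Decidable₁ MissingPacking
missingPacking? p = isColumnPacking? p ×-dec ¬? (p ∈ˡ? columnPackings)

columnPackings-complete : filter missingPacking? (allSubsets 9) ≡ []
columnPackings-complete = refl

∈-columnPackings : ∀ {p} → IsColumnPacking p → p ∈ˡ columnPackings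
∈-columnPackings {p} p-ok = decidable-stable (p ∈ˡ? columnPackings) λ p∉ →
  filter-≡[]⇒∉ {P? = missingPacking?} columnPackings-complete (∈-allSubsets p) (p-ok , p∉)

State : Set
State = Fin (length columnPackings)

stateOf : ∀ {p} → IsColumnPacking p → State
stateOf = index ∘ ∈-columnPackings

lookup-stateOf : ∀ {p} (p-ok : IsColumnPacking p) → lookup columnPackings (stateOf p-ok) ≡ p
lookup-stateOf p-ok = sym (lookup-index (∈-columnPackings p-ok))

weights : (ps : List (Subset 9)) → Vec ℕ (length ps)
weights ps = tabulateᵛ (λ a → ∣ lookup ps a ∣)

weights-lookup : ∀ ps a → lookupᵛ (weights ps) a ≡ ∣ lookup ps a ∣
weights-lookup ps a = lookup∘tabulate (λ a → ∣ lookup ps a ∣) a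

relationTable : (Subset 9 → Subset 9 → Bool) → (ps : List (Subset 9)) → Vec (Vec Bool (length ps)) (length ps)
relationTable R ps = tabulateᵛ (λ a → tabulateᵛ (λ b → R (lookup ps a) (lookup ps b)))

relationTable-[,] : ∀ R ps a b → relationTable R ps [ a , b ] ≡ R (lookup ps a) (lookup ps b)
relationTable-[,] R ps = tabulate-[,] (λ a b → R (lookup ps a) (lookup ps b))

separatedᵇ disjointᵇ : Subset 9 → Subset 9 → Bool
separatedᵇ p q = does (separated? p q)
disjointᵇ  p q = does (disjoint? p q)

open TransferBound (weights columnPackings) (relationTable separatedᵇ columnPackings) (relationTable disjointᵇ columnPackings)

certificate? : Dec (Dominated (table 5) (table 2) 5 × BoundedBy (table 2) 7 × BoundedBy (table 3) 9 × BoundedBy (table 4) 10)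
certificate? = dominated? (table 5) (table 2) 5 ×-dec boundedBy? (table 2) 7 ×-dec boundedBy? (table 3) 9 ×-dec boundedBy? (table 4) 10

opaque
  unfolding table
  certificate : Dominated (table 5) (table 2) 5 × BoundedBy (table 2) 7 × BoundedBy (table 3) 9 × BoundedBy (table 4) 10
  certificate = decided certificate? refl

table-periodic : ∀ i → Dominated (table (5 + i)) (table (2 + i)) 5
table-periodic zero    = proj₁ certificate
table-periodic (suc i) = table-dominated (table-periodic i)

table-bounded : ∀ i → BoundedBy (table (2 + i)) (ρ₉ (4 + i))
table-bounded 0 = proj₁ (proj₂ certificate)
table-bounded 1 = proj₁ (proj₂ (proj₂ certificate))
table-bounded 2 = proj₂ (proj₂ (proj₂ certificate))
table-bounded (suc (suc (suc i))) a b = begin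
  table (5 + i) [ a , b ]     ≤⟨ table-periodic i a b ⟩
  table (2 + i) [ a , b ] + 5 ≤⟨ +-monoˡ-≤ 5 (table-bounded i a b) ⟩
  ρ₉ (4 + i) + 5              ≡⟨ +-comm (ρ₉ (4 + i)) 5 ⟩
  5 + ρ₉ (4 + i)              ≡⟨ ρ₉-step (4 + i) ⟨
  ρ₉ (7 + i)                  ∎
  where open ≤-Reasoning

columnwise-bound : ∀ {P n} → IsColumnwisePacking P → 4 ≤ n → sum (applyUpTo (∣_∣ ∘ P) n) ≤ ρ₉ n
columnwise-bound {P} P-ok (s≤s (s≤s (s≤s (s≤s {n = i} z≤n)))) = begin
  sum (applyUpTo (∣_∣ ∘ P) (4 + i))                                         ≡⟨ sum-applyUpTo-cong weight-state (4 + i) ⟨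
  sum (applyUpTo (lookupᵛ (weights columnPackings) ∘ state) (2 + (2 + i))) ≤⟨ window-bound (2 + i) state admissible ⟩
  table (2 + i) [ state 0 , state 1 ]                                       ≤⟨ table-bounded i (state 0) (state 1) ⟩
  ρ₉ (4 + i)                                                                ∎
  where
  open ≤-Reasoning
  open IsColumnwisePacking P-ok

  state : ℕ → State
  state c = stateOf (packing c)

  weight-state : ∀ c → lookupᵛ (weights columnPackings) (state c) ≡ ∣ P c ∣
  weight-state c = trans (weights-lookup columnPackings (state c)) (cong ∣_∣ (lookup-stateOf (packing c)))

  entry : ∀ R c c′ → R (P c) (P c′) ≡ true → relationTable R columnPackings [ state c , state c′ ] ≡ true
  entry R c c′ r = trans (relationTable-[,] R columnPackings (state c) (state c′))
    (subst₂ (λ p q → R p q ≡ true) (sym (lookup-stateOf (packing c))) (sym (lookup-stateOf (packing c′))) r)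

  admissible : Admissible state
  admissible c = entry separatedᵇ c (suc c) (dec-true (separated? _ _) (separated c)) ,
                 entry disjointᵇ c (suc (suc c)) (dec-true (disjoint? _ _) (disjoint c))

-- C₉ □ P_n: an extremal packing

-- Columns 3t, 3t+1, 3t+2 of the extremal packing carry the rows {t, t+4}, {t+2, t+6}, {t+8} (mod 9).
Phase : Set
Phase = Fin 3 × Fin 9

advance : Phase → Phase
advance (zero , t)           = suc zero , t
advance (suc zero , t)       = suc (suc zero) , t
advance (suc (suc zero) , t) = zero , suc (toℕ t) mod 9

phaseColumn : Phase → Subset 9
phaseColumn (zero , t)           = rows (toℕ t ∷ 4 + toℕ t ∷ [])
phaseColumn (suc zero , t)       = rows (2 + toℕ t ∷ 6 + toℕ t ∷ [])
phaseColumn (suc (suc zero) , t) = rows (8 + toℕ t ∷ [])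

phaseAt : Phase → ℕ → Phase
phaseAt p zero    = p
phaseAt p (suc c) = phaseAt (advance p) c

phaseAt-suc : ∀ p c → phaseAt p (suc c) ≡ advance (phaseAt p c)
phaseAt-suc p zero    = refl
phaseAt-suc p (suc c) = phaseAt-suc (advance p) c

PhaseFits : Phase → Set
PhaseFits p = IsColumnPacking (phaseColumn p)
            × Separated (phaseColumn p) (phaseColumn (advance p))
            × Disjoint (phaseColumn p) (phaseColumn (advance (advance p)))

phaseFits : ∀ p → PhaseFits p
phaseFits (b , t) = decided (all? λ b′ → all? λ t′ → phaseFits? (b′ , t′)) refl b t
  where
  phaseFits? : ∀ p → Dec (PhaseFits p)
  phaseFits? p = isColumnPacking? _ ×-dec separated? _ _ ×-dec disjoint? _ _

phase-weights : ∀ t → ∣ phaseColumn (zero , t) ∣ ≡ 2 × ∣ phaseColumn (suc zero , t) ∣ ≡ 2 × ∣ phaseColumn (suc (suc zero) , t) ∣ ≡ 1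
phase-weights = decided (all? λ t → (∣ phaseColumn (zero , t) ∣ ℕ.≟ 2) ×-dec (∣ phaseColumn (suc zero , t) ∣ ℕ.≟ 2)
                                   ×-dec (∣ phaseColumn (suc (suc zero) , t) ∣ ℕ.≟ 1)) refl

lowerColumns : ℕ → Subset 9
lowerColumns = phaseColumn ∘ phaseAt (zero , zero)

lowerColumns-isColumnwisePacking : IsColumnwisePacking lowerColumns
lowerColumns-isColumnwisePacking = record
  { packing   = λ c → proj₁ (phaseFits (phaseAt (zero , zero) c))
  ; separated = λ c → subst (Separated (lowerColumns c) ∘ phaseColumn) (sym (phaseAt-suc (zero , zero) c))
                            (proj₁ (proj₂ (phaseFits (phaseAt (zero , zero) c))))
  ; disjoint  = λ c → subst (Disjoint (lowerColumns c) ∘ phaseColumn)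
                            (sym (trans (phaseAt-suc (zero , zero) (suc c)) (cong advance (phaseAt-suc (zero , zero) c))))
                            (proj₂ (proj₂ (phaseFits (phaseAt (zero , zero) c))))
  }

sum-phaseColumns : ∀ t n → sum (applyUpTo (∣_∣ ∘ phaseColumn ∘ phaseAt (zero , t)) n) ≡ ρ₉ n
sum-phaseColumns t 0 = refl
sum-phaseColumns t 1 = cong (_+ 0) (proj₁ (phase-weights t))
sum-phaseColumns t 2 = cong₂ _+_ (proj₁ (phase-weights t)) (cong (_+ 0) (proj₁ (proj₂ (phase-weights t))))
sum-phaseColumns t (suc (suc (suc n))) = begin
  ∣ phaseColumn (zero , t) ∣ + (∣ phaseColumn (suc zero , t) ∣ + (∣ phaseColumn (suc (suc zero) , t) ∣
    + sum (applyUpTo (∣_∣ ∘ phaseColumn ∘ phaseAt (zero , suc (toℕ t) mod 9)) n)))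
    ≡⟨ cong₂ _+_ w₀ (cong₂ _+_ w₁ (cong₂ _+_ w₂ (sum-phaseColumns _ n))) ⟩
  5 + ρ₉ n   ≡⟨ ρ₉-step n ⟨
  ρ₉ (3 + n) ∎
  where
  open ≡-Reasoning
  w₀ : ∣ phaseColumn (zero , t) ∣ ≡ 2
  w₀ = proj₁ (phase-weights t)
  w₁ : ∣ phaseColumn (suc zero , t) ∣ ≡ 2
  w₁ = proj₁ (proj₂ (phase-weights t))
  w₂ : ∣ phaseColumn (suc (suc zero) , t) ∣ ≡ 1
  w₂ = proj₂ (proj₂ (phase-weights t))

lemma1 : (n : ℕ) → 4 ≤ n → PackingNumberIs 9 n (2 * n ∸ n / 3)
lemma1 n 4≤n =
  (realise lowerColumns , realise-isPacking lowerColumns-isColumnwisePacking ,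
   trans (length-realise {n = n} lowerColumns) (sum-phaseColumns zero n)) ,
  λ D D-packing → begin
    length D                               ≡⟨ length-packing D-packing ⟩
    length (realise {n = n} (columns D))   ≡⟨ length-realise {n = n} (columns D) ⟩
    sum (applyUpTo (∣_∣ ∘ columns D) n)    ≤⟨ columnwise-bound (columns-isColumnwisePacking D-packing) 4≤n ⟩
    ρ₉ n                                   ∎
  where open ≤-Reasoning
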